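{- Let $n\ge1$ and let $\mathcal T_n$ be the set of rooted trees with $n$ vertices. Then $\max_{T\in\mathcal T_n}\max_{v\in V(T)}R_T(v)$ is attained as $R_T(r)$ for some $T\in\mathcal T_n$ with root $r$. Moreover, for every $T\in\mathcal T_n$ with root $r$, $R_T(r)\le n-1$, with equality if and only if $T$ is a path and $r$ is one of its end vertices.
   Context: For a vertex $v$ of a rooted tree $T$, $T(v)$ is the subtree induced by $v$ and its descendants; a leaf is a vertex with no children. The rank $R_T(v)$ is the minimum distance from $v$ to a leaf of $T(v)$. -}

module Defs where

open import Data.Nat using (ℕ; zero; suc; _+_; _⊓_)
open import Data.List using (List; []; _∷_; _++_; map; length; lookup)
open import Data.Fin using (Fin)

-- Rooted trees: a vertex together with the (finite list of) subtrees
-- rooted at its children.  The root of  node cs  is the outer node.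
data Tree : Set where
  node : List Tree → Tree

children : Tree → List Tree
children (node cs) = cs

-- Vertices of a rooted tree T, given by their (unique) path from the root.
data Pos : Tree → Set where
  here  : ∀ {t} → Pos t
  child : ∀ {cs} (i : Fin (length cs)) → Pos (lookup cs i) → Pos (node cs)

subtree : (t : Tree) → Pos t → Tree
subtree t here = t
subtree (node cs) (child i p) = subtree (lookup cs i) p

mutual
  size : Tree → ℕ
  size (node cs) = suc (sizeF cs)

  sizeF : List Tree → ℕ
  sizeF [] = 0
  sizeF (c ∷ cs) = size c + sizeF cs

mutual
  leafDepths : Tree → List ℕ
  leafDepths (node []) = 0 ∷ []
  leafDepths (node (c ∷ cs)) = map suc (leafDepthsF (c ∷ cs))

  leafDepthsF : List Tree → List ℕ
  leafDepthsF [] = []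
  leafDepthsF (c ∷ cs) = leafDepths c ++ leafDepthsF cs

minL : List ℕ → ℕ
minL [] = 0
minL (x ∷ []) = x
minL (x ∷ y ∷ xs) = x ⊓ minL (y ∷ xs)

rankRoot : Tree → ℕ
rankRoot t = minL (leafDepths t)

R : (T : Tree) → Pos T → ℕ
R T v = rankRoot (subtree T v)

-- degree of a vertex in the underlying (undirected) graph of T:
-- its children plus its parent (if it is not the root)
deg : (T : Tree) → Pos T → ℕ
deg T here = length (children T)
deg (node cs) (child i p) = suc (length (children (subtree (lookup cs i) p)))

-- A tree is a path iff all vertices have degree ≤ 2.
IsPath : Tree → Set
IsPath T = (v : Pos T) → deg T v Data.Nat.≤ 2

IsEndVertex : (T : Tree) → Pos T → Set
IsEndVertex T v = deg T v Data.Nat.≤ 1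

{-# OPTIONS --safe #-}
-- The rank of a root is at most one more than the rank of its first child,
-- so by induction rank < size, and equality forces every vertex to have at
-- most one child (a second child would add vertices without raising the rank):
-- T is a path hanging from one of its ends.  Every R_T(v) is the root rank of
-- a subtree with at most n vertices, so the n-vertex path rooted at an end
-- attains the maximum.
module Submission where

open import Defs
open import Data.Nat using (ℕ; _+_; _≤_; _<_; _∸_; zero; suc; _⊓_; s≤s; z≤n)
open import Data.Nat.Properties
open import Data.List using (List; []; _∷_; _++_; map; length; lookup)
open import Data.List.Properties using (++-identityʳ)
open import Data.Fin using () renaming (zero to fzero; suc to fsuc)
open import Data.Product using (Σ; ∃₂; _×_; _,_)
open import Data.Empty using (⊥-elim)
open import Relation.Binary.PropositionalEquality using (_≡_; refl; cong; trans; module ≡-Reasoning)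
open import Function.Bundles using (_⇔_; mk⇔; Equivalence)

minL-map-suc : ∀ x xs → minL (map suc (x ∷ xs)) ≡ suc (minL (x ∷ xs))
minL-map-suc x []       = refl
minL-map-suc x (y ∷ ys) = cong (suc x ⊓_) (minL-map-suc y ys)

minL-++-≤ : ∀ x xs ys → minL ((x ∷ xs) ++ ys) ≤ minL (x ∷ xs)
minL-++-≤ x []       []       = ≤-refl
minL-++-≤ x []       (y ∷ ys) = m⊓n≤m x _
minL-++-≤ x (y ∷ xs) ys       = ⊓-monoʳ-≤ x (minL-++-≤ y xs ys)

leafDepths-nonempty : ∀ t → ∃₂ λ d ds → leafDepths t ≡ d ∷ ds
leafDepths-nonempty (node [])       = 0 , [] , refl
leafDepths-nonempty (node (c ∷ cs)) with leafDepths-nonempty c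
... | d , ds , eq rewrite eq = suc d , _ , refl

rankRoot-∷-≤ : ∀ c cs → rankRoot (node (c ∷ cs)) ≤ suc (rankRoot c)
rankRoot-∷-≤ c cs with leafDepths c | leafDepths-nonempty c
... | .(d ∷ ds) | d , ds , refl = begin
  minL (map suc ((d ∷ ds) ++ leafDepthsF cs))  ≡⟨ minL-map-suc d (ds ++ leafDepthsF cs) ⟩
  suc (minL ((d ∷ ds) ++ leafDepthsF cs))      ≤⟨ s≤s (minL-++-≤ d ds (leafDepthsF cs)) ⟩
  suc (minL (d ∷ ds))                          ∎
  where open ≤-Reasoning

rankRoot-single : ∀ c → rankRoot (node (c ∷ [])) ≡ suc (rankRoot c)
rankRoot-single c with leafDepths c | leafDepths-nonempty c
... | .(d ∷ ds) | d , ds , refl = begin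
  minL (map suc (d ∷ ds ++ []))  ≡⟨ minL-map-suc d (ds ++ []) ⟩
  suc (minL (d ∷ ds ++ []))      ≡⟨ cong (λ es → suc (minL (d ∷ es))) (++-identityʳ ds) ⟩
  suc (minL (d ∷ ds))            ∎
  where open ≡-Reasoning

size-positive : ∀ t → 0 < size t
size-positive (node cs) = s≤s z≤n

size-lookup-≤ : ∀ cs i → size (lookup cs i) ≤ sizeF cs
size-lookup-≤ (c ∷ cs) fzero    = m≤m+n (size c) (sizeF cs)
size-lookup-≤ (c ∷ cs) (fsuc i) = ≤-trans (size-lookup-≤ cs i) (m≤n+m (sizeF cs) (size c))

size-subtree-≤ : ∀ t v → size (subtree t v) ≤ size t
size-subtree-≤ t         here        = ≤-refl
size-subtree-≤ (node cs) (child i v) =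
  ≤-trans (size-subtree-≤ (lookup cs i) v) (≤-trans (size-lookup-≤ cs i) (n≤1+n (sizeF cs)))

rankRoot<size : ∀ t → rankRoot t < size t
rankRoot<size (node [])       = s≤s z≤n
rankRoot<size (node (c ∷ cs)) = s≤s (begin
  rankRoot (node (c ∷ cs))  ≤⟨ rankRoot-∷-≤ c cs ⟩
  suc (rankRoot c)          ≤⟨ rankRoot<size c ⟩
  size c                    ≤⟨ m≤m+n (size c) (sizeF cs) ⟩
  size c + sizeF cs         ∎)
  where open ≤-Reasoning

R<size : ∀ t v → R t v < size t
R<size t v = ≤-trans (rankRoot<size (subtree t v)) (size-subtree-≤ t v)

rankRoot-branching : ∀ c d cs → suc (rankRoot (node (c ∷ d ∷ cs))) < size (node (c ∷ d ∷ cs))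
rankRoot-branching c d cs = s≤s (begin
  suc (rankRoot (node (c ∷ d ∷ cs)))  ≤⟨ s≤s (rankRoot-∷-≤ c (d ∷ cs)) ⟩
  suc (suc (rankRoot c))              ≤⟨ s≤s (rankRoot<size c) ⟩
  suc (size c)                        ≡⟨ +-comm 1 (size c) ⟩
  size c + 1                          ≤⟨ +-monoʳ-≤ (size c) 1≤size-d+sizeF-cs ⟩
  size c + (size d + sizeF cs)        ∎)
  where
  open ≤-Reasoning

  1≤size-d+sizeF-cs : 1 ≤ size d + sizeF cs
  1≤size-d+sizeF-cs = ≤-trans (size-positive d) (m≤m+n (size d) (sizeF cs))

Unbranched : Tree → Set
Unbranched t = (v : Pos t) → length (children (subtree t v)) ≤ 1

suc-rankRoot≡size⇒unbranched : ∀ t → suc (rankRoot t) ≡ size t → Unbranched t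
suc-rankRoot≡size⇒unbranched (node [])           eq here            = z≤n
suc-rankRoot≡size⇒unbranched (node (c ∷ []))     eq here            = ≤-refl
suc-rankRoot≡size⇒unbranched (node (c ∷ []))     eq (child fzero v) =
  suc-rankRoot≡size⇒unbranched c (suc-injective (begin
    suc (suc (rankRoot c))           ≡⟨ cong suc (rankRoot-single c) ⟨
    suc (rankRoot (node (c ∷ [])))   ≡⟨ eq ⟩
    suc (size c + 0)                 ≡⟨ cong suc (+-identityʳ (size c)) ⟩
    suc (size c)                     ∎)) v
  where open ≡-Reasoning
suc-rankRoot≡size⇒unbranched (node (c ∷ d ∷ cs)) eq v =
  ⊥-elim (<-irrefl eq (rankRoot-branching c d cs))

unbranched⇒suc-rankRoot≡size : ∀ t → Unbranched t → suc (rankRoot t) ≡ size t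
unbranched⇒suc-rankRoot≡size (node [])       u = refl
unbranched⇒suc-rankRoot≡size (node (c ∷ [])) u = begin
  suc (rankRoot (node (c ∷ [])))  ≡⟨ cong suc (rankRoot-single c) ⟩
  suc (suc (rankRoot c))          ≡⟨ cong suc (unbranched⇒suc-rankRoot≡size c (λ v → u (child fzero v))) ⟩
  suc (size c)                    ≡⟨ cong suc (+-identityʳ (size c)) ⟨
  suc (size c + 0)                ∎
  where open ≡-Reasoning
unbranched⇒suc-rankRoot≡size (node (c ∷ d ∷ cs)) u with u here
... | s≤s ()

unbranched⇔path-from-end : ∀ t → Unbranched t ⇔ (IsPath t × IsEndVertex t here)
unbranched⇔path-from-end (node cs) = mk⇔ to from
  where
  to : Unbranched (node cs) → IsPath (node cs) × IsEndVertex (node cs) here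
  to u = (λ { here → ≤-trans (u here) (n≤1+n 1) ; (child i v) → s≤s (u (child i v)) }) , u here

  from : IsPath (node cs) × IsEndVertex (node cs) here → Unbranched (node cs)
  from (path , end) here        = end
  from (path , end) (child i v) = ≤-pred (path (child i v))

chain : ℕ → Tree
chain zero    = node []
chain (suc k) = node (chain k ∷ [])

size-chain : ∀ k → size (chain k) ≡ suc k
size-chain zero    = refl
size-chain (suc k) = cong suc (trans (+-identityʳ (size (chain k))) (size-chain k))

rankRoot-chain : ∀ k → rankRoot (chain k) ≡ k
rankRoot-chain zero    = refl
rankRoot-chain (suc k) = trans (rankRoot-single (chain k)) (cong suc (rankRoot-chain k))

R≤rankRoot-chain : ∀ k T → size T ≡ suc k → (v : Pos T) → R T v ≤ rankRoot (chain k)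
R≤rankRoot-chain .(sizeF cs) (node cs) refl v rewrite rankRoot-chain (sizeF cs) = ≤-pred (R<size (node cs) v)

rankRoot≤size∸1 : ∀ {n} t → size t ≡ n → rankRoot t ≤ n ∸ 1
rankRoot≤size∸1 (node cs) refl = ≤-pred (rankRoot<size (node cs))

rankRoot≡size∸1⇔path-from-end : ∀ {n} t → size t ≡ n → (rankRoot t ≡ n ∸ 1) ⇔ (IsPath t × IsEndVertex t here)
rankRoot≡size∸1⇔path-from-end (node cs) refl = mk⇔
  (λ eq → to (suc-rankRoot≡size⇒unbranched (node cs) (cong suc eq)))
  (λ pe → suc-injective (unbranched⇒suc-rankRoot≡size (node cs) (from pe)))
  where open Equivalence (unbranched⇔path-from-end (node cs))

proposition4p1 : (n : ℕ) → 1 ≤ n →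
    (Σ Tree (λ T → size T ≡ n × ((T′ : Tree) → size T′ ≡ n → (v : Pos T′) → R T′ v ≤ R T here)))
    × ((T : Tree) → size T ≡ n →
        (R T here ≤ n ∸ 1) × ((R T here ≡ n ∸ 1) ⇔ (IsPath T × IsEndVertex T here)))
proposition4p1 (suc k) _ =
  (chain k , size-chain k , R≤rankRoot-chain k) ,
  λ T eq → rankRoot≤size∸1 T eq , rankRoot≡size∸1⇔path-from-end T eq
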